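{- Let $n\geq 2$. The graph $\Gamma(n,3)$ defined below is, up to isomorphism, the unique maximal strongly $(n,3)$-clique-partitioned graph.
   Context: A $v$-clique is a set of $v$ pairwise adjacent vertices. A graph of order $nv$ is weakly $(n,v)$-clique-partitioned if its vertex set can be decomposed in a unique way into $n$ vertex-disjoint $v$-cliques; it is strongly $(n,v)$-clique-partitioned if moreover the only $v$-cliques in it are the $n$ cliques of that decomposition. Every strongly $(n,v)$-clique-partitioned graph has at most $\frac{n}{2}v(v-1)+\frac{nv(n-1)(v-2)}{2}$ edges; one is called maximal if it has exactly this many edges. The graph $\Gamma(n,v)$ has vertex set $\{(i,j):0\leq i\leq n-1,\ 0\leq j\leq v-1\}$, and $(i,j)$ is adjacent to $(k,\ell)$ if and only if one of: (1) $i=k$ and $j\neq \ell$; (2) $i<k$ and $\ell-j\not\equiv 0,1 \pmod v$; (3) $i>k$ and $j-\ell\not\equiv 0,1\pmod v$. -}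

module Defs where

open import Data.Nat using (ℕ; zero; suc; _+_; _*_; _∸_; _≤_; _<ᵇ_; _≤ᵇ_; _%_; NonZero)
open import Data.Nat.DivMod using (_/_)
open import Data.Bool using (Bool; true; false; if_then_else_; _∧_; not)
open import Data.Fin using (Fin; toℕ; remQuot; _≟_)
open import Data.Fin.Subset using (Subset; _∈_; ∣_∣)
open import Data.Fin.Permutation using (Permutation′; _⟨$⟩ʳ_)
open import Data.Product using (Σ; ∃; _×_; _,_)
open import Relation.Binary.PropositionalEquality using (_≡_; _≢_)
open import Relation.Nullary.Decidable using (⌊_⌋)

Graph : ℕ → Set
Graph N = Fin N → Fin N → Bool

IsSimpleGraph : ∀ {N} → Graph N → Set
IsSimpleGraph {N} G = (∀ x y → G x y ≡ G y x) × (∀ x → G x x ≡ false)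

ΣFin : ∀ N → (Fin N → ℕ) → ℕ
ΣFin zero    f = 0
ΣFin (suc N) f = f Fin.zero + ΣFin N (λ i → f (Fin.suc i))

edgeCount : ∀ {N} → Graph N → ℕ
edgeCount {N} G = ΣFin N (λ x → ΣFin N (λ y → if (toℕ x <ᵇ toℕ y) ∧ G x y then 1 else 0))

IsClique : ∀ {N} → Graph N → ℕ → Subset N → Set
IsClique G v S = (∣ S ∣ ≡ v) × (∀ x y → x ∈ S → y ∈ S → x ≢ y → G x y ≡ true)

IsCliqueDecomp : ∀ {N} → Graph N → (n v : ℕ) → (Fin n → Subset N) → Set
IsCliqueDecomp {N} G n v P =
  (∀ i → IsClique G v (P i)) ×
  (∀ i j x → x ∈ P i → x ∈ P j → i ≡ j) ×
  (∀ x → ∃ λ i → x ∈ P i)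

UniqueDecomp : ∀ {N} → Graph N → (n v : ℕ) → (Fin n → Subset N) → Set
UniqueDecomp {N} G n v P =
  ∀ (Q : Fin n → Subset N) → IsCliqueDecomp G n v Q →
    ∃ λ (σ : Permutation′ n) → ∀ i → Q i ≡ P (σ ⟨$⟩ʳ i)

WeaklyCP : (n v : ℕ) → Graph (n * v) → Set
WeaklyCP n v G = IsSimpleGraph G ×
  (Σ (Fin n → Subset (n * v)) λ P → IsCliqueDecomp G n v P × UniqueDecomp G n v P)

StronglyCP : (n v : ℕ) → Graph (n * v) → Set
StronglyCP n v G = IsSimpleGraph G ×
  (Σ (Fin n → Subset (n * v)) λ P → IsCliqueDecomp G n v P × UniqueDecomp G n v P ×
     (∀ S → IsClique G v S → ∃ λ i → S ≡ P i))

-- The bound n/2 v(v-1) + n v (n-1)(v-2)/2 (the total is always an even integer).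
edgeBound : ℕ → ℕ → ℕ
edgeBound n v = (n * (v * (v ∸ 1)) + n * v * (n ∸ 1) * (v ∸ 2)) / 2

MaximalStronglyCP : (n v : ℕ) → Graph (n * v) → Set
MaximalStronglyCP n v G = StronglyCP n v G × (edgeCount G ≡ edgeBound n v)

Isomorphic : ∀ {N} → Graph N → Graph N → Set
Isomorphic {N} G H = ∃ λ (σ : Permutation′ N) → ∀ x y → G x y ≡ H (σ ⟨$⟩ʳ x) (σ ⟨$⟩ʳ y)

-- (ℓ - j) mod v, for j, ℓ ∈ {0,…,v-1}.
diffMod : (v : ℕ) .{{_ : NonZero v}} → Fin v → Fin v → ℕ
diffMod v j ℓ = (toℕ ℓ + (v ∸ toℕ j)) % v

ΓAdj : (n v : ℕ) .{{_ : NonZero v}} → Fin n × Fin v → Fin n × Fin v → Bool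
ΓAdj n v (i , j) (k , ℓ) =
  if ⌊ i ≟ k ⌋ then not ⌊ j ≟ ℓ ⌋
  else if toℕ i <ᵇ toℕ k then 2 ≤ᵇ diffMod v j ℓ
  else 2 ≤ᵇ diffMod v ℓ j

Γ : (n v : ℕ) .{{_ : NonZero v}} → Graph (n * v)
Γ n v x y = ΓAdj n v (remQuot v x) (remQuot v y)

-- Write a vertex as a pair (block, label) with labels in ℤ/3. In Γ(n,3) two vertices of one
-- block are adjacent, and (i,j) ~ (k,l) for i ≠ k iff l = j + s i k, where s i k = 2 if i < k
-- and 1 otherwise; s is a tournament on the blocks that has no directed 3-cycle. Such a graph
-- is (n+1)-regular, its triangles stay inside blocks (a triangle across blocks would need either
-- two neighbours of a vertex in one foreign block or a directed 3-cycle), and the handshake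
-- lemma gives the edge count.
-- Conversely, let G be maximal. Two neighbours of x in a foreign block would form a triangle
-- with x, so x has at most one neighbour in each foreign block and degree at most n+1; since
-- G has as many edges as Γ(n,3), all these bounds are attained and any two blocks are joined
-- by a perfect matching. Labelling the vertices through their partners in a reference block
-- turns every matching into a fixed-point-free permutation of ℤ/3, i.e. a shift by 1 or 2,
-- and the absence of triangles across blocks makes these shifts a tournament without directed
-- 3-cycles. Ranking the blocks along this tournament yields the isomorphism with Γ(n,3).

module Submission where

open import Defs
open import Data.Bool using (Bool; true; false; if_then_else_; _∧_; not) renaming (_≟_ to _≟ᵇ_)
open import Data.Bool.Properties using (¬-not; ∧-conical; ∧-identityʳ; ∧-zeroʳ)
open import Data.Fin using (Fin; zero; suc; toℕ; fromℕ<; _≟_; _<?_; remQuot; combine; _↑ˡ_; _↑ʳ_; punchOut)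
open import Data.Fin.Patterns using (0F; 1F; 2F)
open import Data.Fin.Permutation using (Permutation′; _⟨$⟩ʳ_)
open import Data.Fin.Properties as Finₚ
  using (all?; any?; punchOut-injective; injective⇒≤; remQuot-combine; combine-remQuot; combine-injective; combine-injectiveʳ; toℕ-fromℕ<)
open import Data.Fin.Subset using (Subset; _∈_; _⊆_; ∣_∣)
open import Data.Nat using (ℕ; zero; suc; _+_; _*_; _∸_; _≤_; _<_; _<ᵇ_; _≤ᵇ_; z≤n; s≤s)
open import Data.Nat.DivMod using (_mod_; _/_; m*n/n≡m)
open import Data.Nat.Properties as ℕ using (+-0-commutativeMonoid)
open import Data.Nat.Tactic.RingSolver using (solve-∀)
open import Data.Product using (Σ; ∃; _×_; _,_; proj₁; proj₂)
open import Data.Sum using (inj₁; inj₂)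
open import Data.Vec using ([]; _∷_; lookup; tabulate)
open import Data.Vec.Functional using () renaming (_∷_ to _◂_)
open import Data.Vec.Properties using (lookup∘tabulate; tabulate∘lookup; tabulate-cong; []=⇒lookup; lookup⇒[]=)
open import Function.Base using (_∘_)
open import Function.Bundles using (mk↔ₛ′; mk⇔)
open import Function.Definitions using (Injective)
open import Relation.Binary.Consequences using (tri⇒dec<)
open import Relation.Binary.Definitions using (Trichotomous; Transitive; tri<; tri≈; tri>)
open import Relation.Binary.PropositionalEquality
  using (_≡_; _≢_; refl; sym; trans; cong; cong₂; subst; subst₂; _≗_; module ≡-Reasoning)
open import Relation.Nullary using (Dec; yes; no; ¬_; contradiction)
open import Relation.Nullary.Decidable using (does; from-yes; dec-true; dec-false; does-⇔; isYes≗does; _→-dec_; _×-dec_; ¬?)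

open import Algebra.Properties.CommutativeMonoid.Sum +-0-commutativeMonoid
  using (sum; sum-syntax; sum-cong-≗; sum-replicate-zero; ∑-distrib-+; ∑-comm)

-- Sums and counting

ΣFin≡sum : ∀ N (f : Fin N → ℕ) → ΣFin N f ≡ sum f
ΣFin≡sum zero    f = refl
ΣFin≡sum (suc N) f = cong (f zero +_) (ΣFin≡sum N (λ i → f (suc i)))

∑-const : ∀ N c → ∑[ i < N ] c ≡ N * c
∑-const zero    c = refl
∑-const (suc N) c = cong (c +_) (∑-const N c)

∑-mono-≤ : ∀ {N} {f g : Fin N → ℕ} → (∀ i → f i ≤ g i) → sum f ≤ sum g
∑-mono-≤ {zero}  f≤g = z≤n
∑-mono-≤ {suc N} f≤g = ℕ.+-mono-≤ (f≤g zero) (∑-mono-≤ (λ i → f≤g (suc i)))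

∑-≤-≡⇒≗ : ∀ {N} {f g : Fin N → ℕ} → (∀ i → f i ≤ g i) → sum f ≡ sum g → f ≗ g
∑-≤-≡⇒≗ {suc N} {f} {g} f≤g ∑f≡∑g = pointwise
  where
  head≡ : f zero ≡ g zero
  head≡ with ℕ.m≤n⇒m<n∨m≡n (f≤g zero)
  ... | inj₂ eq = eq
  ... | inj₁ lt = contradiction ∑f≡∑g (ℕ.<⇒≢ (ℕ.+-mono-<-≤ lt (∑-mono-≤ (λ i → f≤g (suc i)))))
  tail≡ : sum (λ i → f (suc i)) ≡ sum (λ i → g (suc i))
  tail≡ = ℕ.+-cancelˡ-≡ (f zero) _ _ (trans ∑f≡∑g (cong (_+ _) (sym head≡)))
  pointwise : f ≗ g
  pointwise zero    = head≡
  pointwise (suc i) = ∑-≤-≡⇒≗ (λ i → f≤g (suc i)) tail≡ i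

∑-↑ : ∀ m k (f : Fin (m + k) → ℕ) → sum f ≡ sum (λ i → f (i ↑ˡ k)) + sum (λ j → f (m ↑ʳ j))
∑-↑ zero    k f = refl
∑-↑ (suc m) k f = trans (cong (f zero +_) (∑-↑ m k (λ x → f (suc x)))) (sym (ℕ.+-assoc (f zero) _ _))

∑-combine : ∀ n k (f : Fin (n * k) → ℕ) → sum f ≡ ∑[ i < n ] ∑[ j < k ] f (combine i j)
∑-combine zero    k f = refl
∑-combine (suc n) k f =
  trans (∑-↑ k (n * k) f) (cong (sum (λ j → f (j ↑ˡ (n * k))) +_) (∑-combine n k (λ x → f (k ↑ʳ x))))

bit : Bool → ℕ
bit b = if b then 1 else 0

bit-mono : ∀ {a b} → (a ≡ true → b ≡ true) → bit a ≤ bit b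
bit-mono {false} a⇒b = z≤n
bit-mono {true}  a⇒b rewrite a⇒b refl = s≤s z≤n

bit-injective : ∀ {a b} → bit a ≡ bit b → a ≡ b
bit-injective {false} {false} _ = refl
bit-injective {true}  {true}  _ = refl

does⇒ : ∀ {a} {A : Set a} (a? : Dec A) → does a? ≡ true → A
does⇒ (yes a) _ = a

bool-does : ∀ {a} {A : Set} → (a ≡ true → A) → (A → a ≡ true) → (a? : Dec A) → a ≡ does a?
bool-does a⇒A A⇒a (yes A-holds) = A⇒a A-holds
bool-does a⇒A A⇒a (no ¬A)       = ¬-not (λ a≡true → ¬A (a⇒A a≡true))

count : ∀ {N} → (Fin N → Bool) → ℕ
count {N} p = ∑[ x < N ] bit (p x)

_∖_ : ∀ {N} → (Fin N → Bool) → Fin N → (Fin N → Bool)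
(p ∖ x) y = p y ∧ not (does (x ≟ y))

∖-intro : ∀ {N} (p : Fin N → Bool) {x y} → p y ≡ true → x ≢ y → (p ∖ x) y ≡ true
∖-intro p {x} {y} py x≢y rewrite py | dec-false (x ≟ y) x≢y = refl

∖-≢ : ∀ {N} (p : Fin N → Bool) {x y} → (p ∖ x) y ≡ true → x ≢ y
∖-≢ p {x} {y} h x≡y with p y | x ≟ y
... | true | no x≢y = x≢y x≡y

count-≟ : ∀ {N} (x : Fin N) → count (λ y → does (x ≟ y)) ≡ 1
count-≟ {suc N} zero    = cong suc (sum-replicate-zero N)
count-≟ {suc N} (suc x) = count-≟ {N} x

∑-suc-≟ : ∀ {n} (i : Fin n) → ∑[ k < n ] suc (bit (does (i ≟ k))) ≡ suc n
∑-suc-≟ {n} i = begin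
  ∑[ k < n ] (1 + bit (does (i ≟ k)))        ≡⟨ ∑-distrib-+ (λ _ → 1) (λ k → bit (does (i ≟ k))) ⟩
  ∑[ k < n ] 1 + count (λ k → does (i ≟ k))  ≡⟨ cong₂ _+_ (trans (∑-const n 1) (ℕ.*-identityʳ n)) (count-≟ i) ⟩
  n + 1                                      ≡⟨ ℕ.+-comm n 1 ⟩
  suc n                                      ∎
  where open ≡-Reasoning

count-none : ∀ {N} (p : Fin N → Bool) → (∀ x → p x ≢ true) → count p ≡ 0
count-none {N} p none = trans (sum-cong-≗ (λ x → cong bit (¬-not (none x)))) (sum-replicate-zero N)

count-mono : ∀ {N} (p q : Fin N → Bool) → (∀ x → p x ≡ true → q x ≡ true) → count p ≤ count q
count-mono p q p⇒q = ∑-mono-≤ (λ x → bit-mono (p⇒q x))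

count-remove : ∀ {N} (p : Fin N → Bool) {x} → p x ≡ true → count p ≡ suc (count (p ∖ x))
count-remove {N} p {x} px = begin
  count p                                             ≡⟨ sum-cong-≗ split ⟩
  ∑[ y < N ] (bit ((p ∖ x) y) + bit (does (x ≟ y)))   ≡⟨ ∑-distrib-+ (λ y → bit ((p ∖ x) y)) (λ y → bit (does (x ≟ y))) ⟩
  count (p ∖ x) + count (λ y → does (x ≟ y))          ≡⟨ cong (count (p ∖ x) +_) (count-≟ x) ⟩
  count (p ∖ x) + 1                                   ≡⟨ ℕ.+-comm _ 1 ⟩
  suc (count (p ∖ x))                                 ∎
  where
  open ≡-Reasoning
  split : ∀ y → bit (p y) ≡ bit ((p ∖ x) y) + bit (does (x ≟ y))
  split y with x ≟ y
  ... | yes refl rewrite px = refl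
  ... | no _ with p y
  ...   | true  = refl
  ...   | false = refl

count-pos : ∀ {N} (p : Fin N → Bool) {x} → p x ≡ true → 0 < count p
count-pos p px = subst (0 <_) (sym (count-remove p px)) (s≤s z≤n)

count-pos⇒∃ : ∀ {N} (p : Fin N → Bool) → 0 < count p → ∃ λ x → p x ≡ true
count-pos⇒∃ {suc N} p pos with p zero in eq
... | true  = zero , eq
... | false with count-pos⇒∃ (λ x → p (suc x)) pos
...   | x , px = suc x , px

count≤1 : ∀ {N} (p : Fin N → Bool) → (∀ x y → p x ≡ true → p y ≡ true → x ≡ y) → count p ≤ 1
count≤1 p unique with any? (λ x → p x ≟ᵇ true)
... | yes (x , px) = ℕ.≤-trans (count-mono p (λ y → does (x ≟ y)) (λ y py → dec-true (x ≟ y) (unique x y px py)))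
                               (ℕ.≤-reflexive (count-≟ x))
... | no  none     = ℕ.≤-trans (ℕ.≤-reflexive (count-none p (λ x px → none (x , px)))) z≤n

count≡1⇒unique : ∀ {N} (p : Fin N → Bool) {x y} → count p ≡ 1 → p x ≡ true → p y ≡ true → x ≡ y
count≡1⇒unique p {x} {y} one px py with x ≟ y
... | yes x≡y = x≡y
... | no  x≢y = contradiction (ℕ.suc-injective (trans (sym (count-remove p px)) one))
                              (ℕ.>⇒≢ (count-pos (p ∖ x) (∖-intro p py x≢y)))

-- Subsets of a given size

lookup-ext : ∀ {N} {S T : Subset N} → (∀ x → lookup S x ≡ lookup T x) → S ≡ T
lookup-ext {S = S} {T} h = trans (sym (tabulate∘lookup S)) (trans (tabulate-cong h) (tabulate∘lookup T))

∈⇒lookup : ∀ {N} {S : Subset N} {x} → x ∈ S → lookup S x ≡ true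
∈⇒lookup = []=⇒lookup

lookup⇒∈ : ∀ {N} {S : Subset N} {x} → lookup S x ≡ true → x ∈ S
lookup⇒∈ {S = S} {x} = lookup⇒[]= x S

∣∣≡count : ∀ {N} (S : Subset N) → ∣ S ∣ ≡ count (lookup S)
∣∣≡count []          = refl
∣∣≡count (true ∷ S)  = cong suc (∣∣≡count S)
∣∣≡count (false ∷ S) = ∣∣≡count S

∣∣≡suc⇒nonempty : ∀ {N k} (S : Subset N) → ∣ S ∣ ≡ suc k → ∃ λ x → x ∈ S
∣∣≡suc⇒nonempty S size with count-pos⇒∃ (lookup S) (subst (0 <_) (trans (sym size) (∣∣≡count S)) (s≤s z≤n))
... | x , x∈S = x , lookup⇒∈ x∈S

⊆∧∣∣≡⇒≡ : ∀ {N} {S T : Subset N} → S ⊆ T → ∣ S ∣ ≡ ∣ T ∣ → S ≡ T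
⊆∧∣∣≡⇒≡ {S = S} {T} S⊆T ∣S∣≡∣T∣ = lookup-ext (λ x → bit-injective (bits≗ x))
  where
  bits≗ : (λ x → bit (lookup S x)) ≗ (λ x → bit (lookup T x))
  bits≗ = ∑-≤-≡⇒≗ (λ x → bit-mono (λ x∈S → ∈⇒lookup (S⊆T (lookup⇒∈ x∈S))))
            (trans (sym (∣∣≡count S)) (trans ∣S∣≡∣T∣ (∣∣≡count T)))

hits : ∀ {k N} → (Fin k → Fin N) → Fin N → Bool
hits e x = does (any? (λ j → e j ≟ x))

image : ∀ {k N} → (Fin k → Fin N) → Subset N
image e = tabulate (hits e)

hits-∋ : ∀ {k N} (e : Fin k → Fin N) j → hits e (e j) ≡ true
hits-∋ e j = dec-true (any? (λ i → e i ≟ e j)) (j , refl)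

hits⇒∃ : ∀ {k N} (e : Fin k → Fin N) {x} → hits e x ≡ true → ∃ λ j → e j ≡ x
hits⇒∃ e {x} = does⇒ (any? (λ j → e j ≟ x))

∈-image : ∀ {k N} (e : Fin k → Fin N) {x} → x ∈ image e → ∃ λ j → e j ≡ x
∈-image e {x} x∈ = hits⇒∃ e (trans (sym (lookup∘tabulate (hits e) x)) (∈⇒lookup x∈))

image-∋ : ∀ {k N} (e : Fin k → Fin N) j → e j ∈ image e
image-∋ e j = lookup⇒∈ (trans (lookup∘tabulate (hits e) (e j)) (hits-∋ e j))

count-hits : ∀ {k N} (e : Fin k → Fin N) → Injective _≡_ _≡_ e → count (hits e) ≡ k
count-hits {zero}  e injective = count-none (hits e) (λ x ())
count-hits {suc k} e injective = trans (count-remove (hits e) (hits-∋ e zero))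
  (cong suc (trans (sum-cong-≗ (λ x → cong bit (hits∖head x)))
                   (count-hits (λ j → e (suc j)) (λ eq → Finₚ.suc-injective (injective eq)))))
  where
  hits∖head : ∀ x → (hits e ∖ e zero) x ≡ hits (λ j → e (suc j)) x
  hits∖head x with e zero ≟ x
  ... | yes refl = sym (¬-not (λ h → Finₚ.0≢1+n (injective (sym (proj₂ (hits⇒∃ (λ j → e (suc j)) h))))))
  ... | no _     = ∧-identityʳ _

∣image∣ : ∀ {k N} (e : Fin k → Fin N) → Injective _≡_ _≡_ e → ∣ image e ∣ ≡ k
∣image∣ e injective =
  trans (∣∣≡count (image e)) (trans (sum-cong-≗ (λ x → cong bit (lookup∘tabulate (hits e) x))) (count-hits e injective))

enumerate-count : ∀ {k N} (p : Fin N → Bool) → count p ≡ k →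
  Σ (Fin k → Fin N) λ e → Injective _≡_ _≡_ e × p ≗ hits e
enumerate-count {zero}  p none = (λ ()) , (λ {}) , λ x → ¬-not (λ px → ℕ.<⇒≢ (count-pos p px) (sym none))
enumerate-count {suc k} p size with count-pos⇒∃ p (subst (0 <_) (sym size) (s≤s z≤n))
... | x , px with enumerate-count (p ∖ x) (ℕ.suc-injective (trans (sym (count-remove p px)) size))
...   | e , e-injective , p∖x≗ = x ◂ e , injective , pointwise
  where
  x∉e : ∀ j → x ≢ e j
  x∉e j = ∖-≢ p (trans (p∖x≗ (e j)) (hits-∋ e j))
  injective : Injective _≡_ _≡_ (x ◂ e)
  injective {zero}  {zero}  _  = refl
  injective {zero}  {suc j} eq = contradiction eq (x∉e j)
  injective {suc i} {zero}  eq = contradiction (sym eq) (x∉e i)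
  injective {suc i} {suc j} eq = cong suc (e-injective eq)
  pointwise : p ≗ hits (x ◂ e)
  pointwise y with x ≟ y
  ... | yes refl = px
  ... | no  x≢y  = trans (sym (∧-identityʳ (p y))) (trans (cong (λ b → p y ∧ not b) (sym (dec-false (x ≟ y) x≢y))) (p∖x≗ y))

opaque
  enumerate : ∀ {k N} (S : Subset N) → ∣ S ∣ ≡ k → Σ (Fin k → Fin N) λ e → Injective _≡_ _≡_ e × S ≡ image e
  enumerate S size with enumerate-count (lookup S) (trans (sym (∣∣≡count S)) size)
  ... | e , e-injective , S≗ = e , e-injective , lookup-ext (λ x → trans (S≗ x) (sym (lookup∘tabulate (hits e) x)))

injective⇒surjective : ∀ {N} (f : Fin N → Fin N) → Injective _≡_ _≡_ f → ∀ y → ∃ λ x → f x ≡ y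
injective⇒surjective {suc M} f injective y with any? (λ x → f x ≟ y)
... | yes hit  = hit
... | no  miss = contradiction (injective⇒≤ punched-injective) ℕ.1+n≰n
  where
  punched : Fin (suc M) → Fin M
  punched x = punchOut {i = y} {j = f x} (λ eq → miss (x , sym eq))
  punched-injective : Injective _≡_ _≡_ punched
  punched-injective {a} {b} eq = injective (punchOut-injective (λ eq → miss (a , sym eq)) (λ eq → miss (b , sym eq)) eq)

injective⇒permutation : ∀ {N} (f : Fin N → Fin N) → Injective _≡_ _≡_ f →
  Σ (Permutation′ N) λ π → ∀ x → π ⟨$⟩ʳ x ≡ f x
injective⇒permutation f injective =
  mk↔ₛ′ f (λ y → proj₁ (surjective y)) (λ y → proj₂ (surjective y)) (λ x → injective (proj₂ (surjective (f x)))) ,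
  λ x → refl
  where
  surjective : ∀ y → ∃ λ x → f x ≡ y
  surjective = injective⇒surjective f injective

-- Graphs

degree : ∀ {N} → Graph N → Fin N → ℕ
degree G x = count (G x)

handshake : ∀ {N} (G : Graph N) → IsSimpleGraph G → ∑[ x < N ] degree G x ≡ edgeCount G + edgeCount G
handshake {N} G (symmetric , irreflexive) = begin
  ∑[ x < N ] degree G x
    ≡⟨ sum-cong-≗ (λ x → trans (sum-cong-≗ (split x)) (∑-distrib-+ (forward x) (backward x))) ⟩
  ∑[ x < N ] (∑[ y < N ] forward x y + ∑[ y < N ] backward x y)
    ≡⟨ ∑-distrib-+ (λ x → ∑[ y < N ] forward x y) (λ x → ∑[ y < N ] backward x y) ⟩
  ∑[ x < N ] ∑[ y < N ] forward x y + ∑[ x < N ] ∑[ y < N ] backward x y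
    ≡⟨ cong (∑[ x < N ] ∑[ y < N ] forward x y +_) (trans (∑-comm backward) (sum-cong-≗ λ y → sum-cong-≗ λ x →
         cong (λ b → bit (does (y <? x) ∧ b)) (symmetric x y))) ⟩
  ∑[ x < N ] ∑[ y < N ] forward x y + ∑[ y < N ] ∑[ x < N ] forward y x
    ≡⟨ cong₂ _+_ (sym edgeCount≡) (sym edgeCount≡) ⟩
  edgeCount G + edgeCount G
    ∎
  where
  open ≡-Reasoning
  forward backward : Fin N → Fin N → ℕ
  forward  x y = bit (does (x <? y) ∧ G x y)
  backward x y = bit (does (y <? x) ∧ G x y)
  edgeCount≡ : edgeCount G ≡ ∑[ x < N ] ∑[ y < N ] forward x y
  edgeCount≡ = trans (ΣFin≡sum N (λ x → ΣFin N (forward x))) (sum-cong-≗ (λ x → ΣFin≡sum N (forward x)))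
  split : ∀ x y → bit (G x y) ≡ forward x y + backward x y
  split x y with Finₚ.<-cmp x y
  ... | tri< x<y _ y≮x rewrite dec-true (x <? y) x<y | dec-false (y <? x) y≮x = sym (ℕ.+-identityʳ _)
  ... | tri≈ _ refl _ rewrite irreflexive x | ∧-zeroʳ (does (x <? x)) = refl
  ... | tri> x≮y _ y<x rewrite dec-false (x <? y) x≮y | dec-true (y <? x) y<x = refl

adjacent⇒≢ : ∀ {N} {G : Graph N} → IsSimpleGraph G → ∀ {x y} → G x y ≡ true → x ≢ y
adjacent⇒≢ (_ , irreflexive) {x} Gxy refl = contradiction (trans (sym Gxy) (irreflexive x)) λ ()

image-clique : ∀ {k N} {G : Graph N} → IsSimpleGraph G → (t : Fin k → Fin N) →
  (∀ i j → i ≢ j → G (t i) (t j) ≡ true) → IsClique G k (image t)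
image-clique {G = G} simple t adjacent = ∣image∣ t injective , clique
  where
  injective : Injective _≡_ _≡_ t
  injective {i} {j} tᵢ≡tⱼ with i ≟ j
  ... | yes i≡j = i≡j
  ... | no  i≢j = contradiction tᵢ≡tⱼ (adjacent⇒≢ simple (adjacent i j i≢j))
  clique : ∀ x y → x ∈ image t → y ∈ image t → x ≢ y → G x y ≡ true
  clique x y x∈ y∈ x≢y with ∈-image t x∈ | ∈-image t y∈
  ... | i , refl | j , refl = adjacent i j (λ i≡j → x≢y (cong t i≡j))

triangle-clique : ∀ {N} {G : Graph N} → IsSimpleGraph G → ∀ {x y z} →
  G x y ≡ true → G y z ≡ true → G x z ≡ true → IsClique G 3 (image (lookup (x ∷ y ∷ z ∷ [])))
triangle-clique {G = G} simple@(symmetric , _) {x} {y} {z} xy yz xz = image-clique simple (lookup (x ∷ y ∷ z ∷ [])) adjacent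
  where
  adjacent : ∀ i j → i ≢ j → G (lookup (x ∷ y ∷ z ∷ []) i) (lookup (x ∷ y ∷ z ∷ []) j) ≡ true
  adjacent 0F 1F _ = xy
  adjacent 0F 2F _ = xz
  adjacent 1F 0F _ = trans (symmetric y x) xy
  adjacent 1F 2F _ = yz
  adjacent 2F 0F _ = trans (symmetric z x) xz
  adjacent 2F 1F _ = trans (symmetric z y) yz
  adjacent 0F 0F i≢i = contradiction refl i≢i
  adjacent 1F 1F i≢i = contradiction refl i≢i
  adjacent 2F 2F i≢i = contradiction refl i≢i

cliques-are-blocks⇒unique : ∀ {N n v} {G : Graph N} {P : Fin n → Subset N} →
  (∀ S → IsClique G (suc v) S → ∃ λ i → S ≡ P i) → UniqueDecomp G n (suc v) P
cliques-are-blocks⇒unique {n = n} {P = P} blocks Q (Q-cliques , Q-disjoint , _) =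
  proj₁ π , λ i → trans (Qᵢ≡P i) (cong P (sym (proj₂ π i)))
  where
  τ : Fin n → Fin n
  τ i = proj₁ (blocks (Q i) (Q-cliques i))
  Qᵢ≡P : ∀ i → Q i ≡ P (τ i)
  Qᵢ≡P i = proj₂ (blocks (Q i) (Q-cliques i))
  τ-injective : Injective _≡_ _≡_ τ
  τ-injective {i} {j} τᵢ≡τⱼ with ∣∣≡suc⇒nonempty (Q i) (proj₁ (Q-cliques i))
  ... | x , x∈Qᵢ = Q-disjoint i j x x∈Qᵢ (subst (x ∈_) (trans (Qᵢ≡P i) (trans (cong P τᵢ≡τⱼ) (sym (Qᵢ≡P j)))) x∈Qᵢ)
  π : Σ (Permutation′ n) λ π → ∀ i → π ⟨$⟩ʳ i ≡ τ i
  π = injective⇒permutation τ τ-injective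

-- ℤ/3

infixl 6 _⊕_

_⊕_ : Fin 3 → Fin 3 → Fin 3
a ⊕ b = (toℕ a + toℕ b) mod 3

⊖_ : Fin 3 → Fin 3
⊖ a = (3 ∸ toℕ a) mod 3

⊕-identityˡ : ∀ a → 0F ⊕ a ≡ a
⊕-identityˡ = from-yes (all? λ a → 0F ⊕ a ≟ a)

⊕-assoc : ∀ a b c → a ⊕ b ⊕ c ≡ a ⊕ (b ⊕ c)
⊕-assoc = from-yes (all? λ a → all? λ b → all? λ c → a ⊕ b ⊕ c ≟ a ⊕ (b ⊕ c))

⊕-injectiveˡ : ∀ a j l → j ⊕ a ≡ l ⊕ a → j ≡ l
⊕-injectiveˡ = from-yes (all? λ a → all? λ j → all? λ l → (j ⊕ a ≟ l ⊕ a) →-dec (j ≟ l))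

⊕-cancelˡ : ∀ j a b c → j ⊕ a ⊕ b ≡ j ⊕ c → a ⊕ b ≡ c
⊕-cancelˡ = from-yes (all? λ j → all? λ a → all? λ b → all? λ c → (j ⊕ a ⊕ b ≟ j ⊕ c) →-dec (a ⊕ b ≟ c))

⊕-⊖-cancel : ∀ j a → j ⊕ a ⊕ ⊖ a ≡ j
⊕-⊖-cancel = from-yes (all? λ j → all? λ a → j ⊕ a ⊕ ⊖ a ≟ j)

⊕-inverse-unique : ∀ j a b → j ⊕ a ⊕ b ≡ j → b ≡ ⊖ a
⊕-inverse-unique = from-yes (all? λ j → all? λ a → all? λ b → (j ⊕ a ⊕ b ≟ j) →-dec (b ≟ ⊖ a))

⊕-transpose : ∀ a j l → does (j ⊕ a ≟ l) ≡ does (l ⊕ ⊖ a ≟ j)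
⊕-transpose = from-yes (all? λ a → all? λ j → all? λ l → does (j ⊕ a ≟ l) ≟ᵇ does (l ⊕ ⊖ a ≟ j))

j⊕1≢j : ∀ j → j ⊕ 1F ≢ j
j⊕1≢j = from-yes (all? λ j → ¬? (j ⊕ 1F ≟ j))

j⊕2⊕1≡j : ∀ j → j ⊕ 2F ⊕ 1F ≡ j
j⊕2⊕1≡j = from-yes (all? λ j → j ⊕ 2F ⊕ 1F ≟ j)

≢0∧≢1⇒≡2 : ∀ a → a ≢ 0F → a ≢ 1F → a ≡ 2F
≢0∧≢1⇒≡2 = from-yes (all? λ (a : Fin 3) → ¬? (a ≟ 0F) →-dec ¬? (a ≟ 1F) →-dec (a ≟ 2F))

≢0∧≢2⇒⊖≡2 : ∀ a → a ≢ 0F → a ≢ 2F → ⊖ a ≡ 2F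
≢0∧≢2⇒⊖≡2 = from-yes (all? λ (a : Fin 3) → ¬? (a ≟ 0F) →-dec ¬? (a ≟ 2F) →-dec (⊖ a ≟ 2F))

count-≢ : ∀ (j : Fin 3) → count (λ l → not (does (j ≟ l))) ≡ 2
count-≢ = from-yes (all? λ (j : Fin 3) → count {3} (λ l → not (does (j ≟ l))) ℕ.≟ 2)

derangement-is-rotation : (f : Fin 3 → Fin 3) → Injective _≡_ _≡_ f → (∀ j → f j ≢ j) → ∀ j → f j ≡ j ⊕ f 0F
derangement-is-rotation f injective fixed-point-free = rotation
  where
  values : ∀ a b c → a ≢ 0F → b ≢ 1F → c ≢ 2F → a ≢ b → a ≢ c → b ≢ c → b ≡ 1F ⊕ a × c ≡ 2F ⊕ a
  values = from-yes (all? λ a → all? λ b → all? λ c →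
    ¬? (a ≟ 0F) →-dec ¬? (b ≟ 1F) →-dec ¬? (c ≟ 2F) →-dec ¬? (a ≟ b) →-dec ¬? (a ≟ c) →-dec ¬? (b ≟ c) →-dec
    ((b ≟ 1F ⊕ a) ×-dec (c ≟ 2F ⊕ a)))
  distinct : ∀ {i j} → i ≢ j → f i ≢ f j
  distinct i≢j fᵢ≡fⱼ = i≢j (injective fᵢ≡fⱼ)
  f-values : f 1F ≡ 1F ⊕ f 0F × f 2F ≡ 2F ⊕ f 0F
  f-values = values (f 0F) (f 1F) (f 2F) (fixed-point-free 0F) (fixed-point-free 1F) (fixed-point-free 2F)
                    (distinct λ ()) (distinct λ ()) (distinct λ ())
  rotation : ∀ j → f j ≡ j ⊕ f 0F
  rotation 0F = sym (⊕-identityˡ (f 0F))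
  rotation 1F = proj₁ f-values
  rotation 2F = proj₂ f-values

-- Shift graphs

opaque
  ShiftAdj : ∀ {n} → (Fin n → Fin n → Fin 3) → Fin n × Fin 3 → Fin n × Fin 3 → Bool
  ShiftAdj s (i , j) (k , l) = if does (i ≟ k) then not (does (j ≟ l)) else does (j ⊕ s i k ≟ l)

  ShiftAdj-within : ∀ {n} {s : Fin n → Fin n → Fin 3} {i k} j l → i ≡ k → ShiftAdj s (i , j) (k , l) ≡ not (does (j ≟ l))
  ShiftAdj-within {i = i} j l refl rewrite dec-true (i ≟ i) refl = refl

  ShiftAdj-across : ∀ {n} {s : Fin n → Fin n → Fin 3} {i k} j l → i ≢ k → ShiftAdj s (i , j) (k , l) ≡ does (j ⊕ s i k ≟ l)
  ShiftAdj-across {i = i} {k} j l i≢k rewrite dec-false (i ≟ k) i≢k = refl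

-- s b c ∈ {1, 2} orients the pair {b, c}, with 2 meaning b → c; acyclic forbids directed 3-cycles.
record IsTransitiveTournament {n} (s : Fin n → Fin n → Fin 3) : Set where
  field
    nonzero : ∀ {b c} → b ≢ c → s b c ≢ 0F
    antisym : ∀ {b c} → b ≢ c → s c b ≡ ⊖ s b c
    acyclic : ∀ {b c d} → b ≢ c → c ≢ d → b ≢ d → s b c ⊕ s c d ≢ s b d

module _ {n} {s : Fin n → Fin n → Fin 3} where

  within⇒≢ : ∀ {i j l} → ShiftAdj s (i , j) (i , l) ≡ true → j ≢ l
  within⇒≢ {i} {j} {l} adj j≡l =
    contradiction (trans (sym adj) (trans (ShiftAdj-within j l refl) (cong not (dec-true (j ≟ l) j≡l)))) λ ()

  across⇒ : ∀ {i j k l} → i ≢ k → ShiftAdj s (i , j) (k , l) ≡ true → j ⊕ s i k ≡ l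
  across⇒ {j = j} {k} {l} i≢k adj = does⇒ (j ⊕ _ ≟ l) (trans (sym (ShiftAdj-across j l i≢k)) adj)

  ShiftAdj-irreflexive : ∀ p → ShiftAdj s p p ≡ false
  ShiftAdj-irreflexive (i , j) = trans (ShiftAdj-within j j refl) (cong not (dec-true (j ≟ j) refl))

  module _ (tournament : IsTransitiveTournament s) where
    open IsTransitiveTournament tournament

    ShiftAdj-symmetric : ∀ p q → ShiftAdj s p q ≡ ShiftAdj s q p
    ShiftAdj-symmetric (i , j) (k , l) with i ≟ k
    ... | yes refl = trans (ShiftAdj-within j l refl)
                           (trans (cong not (does-⇔ (mk⇔ sym sym) (j ≟ l) (l ≟ j))) (sym (ShiftAdj-within l j refl)))
    ... | no  i≢k  = begin
      ShiftAdj s (i , j) (k , l) ≡⟨ ShiftAdj-across j l i≢k ⟩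
      does (j ⊕ s i k ≟ l)       ≡⟨ ⊕-transpose (s i k) j l ⟩
      does (l ⊕ ⊖ s i k ≟ j)     ≡⟨ cong (λ a → does (l ⊕ a ≟ j)) (sym (antisym i≢k)) ⟩
      does (l ⊕ s k i ≟ j)       ≡⟨ sym (ShiftAdj-across l j (λ k≡i → i≢k (sym k≡i))) ⟩
      ShiftAdj s (k , l) (i , j) ∎
      where open ≡-Reasoning

    ShiftAdj-triangle : ∀ {i₁ j₁ i₂ j₂ i₃ j₃} → ShiftAdj s (i₁ , j₁) (i₂ , j₂) ≡ true →
      ShiftAdj s (i₂ , j₂) (i₃ , j₃) ≡ true → ShiftAdj s (i₁ , j₁) (i₃ , j₃) ≡ true → i₁ ≡ i₂
    ShiftAdj-triangle {i₁} {j₁} {i₂} {j₂} {i₃} {j₃} a₁₂ a₂₃ a₁₃ with i₁ ≟ i₂ | i₂ ≟ i₃ | i₁ ≟ i₃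
    ... | yes i₁≡i₂ | _ | _ = i₁≡i₂
    ... | no i₁≢i₂ | yes refl | _ = contradiction (trans (sym (across⇒ i₁≢i₂ a₁₂)) (across⇒ i₁≢i₂ a₁₃)) (within⇒≢ a₂₃)
    ... | no i₁≢i₂ | no i₂≢i₃ | yes refl = contradiction j₁≡j₃ (within⇒≢ a₁₃)
      where
      j₁≡j₃ : j₁ ≡ j₃
      j₁≡j₃ = begin
        j₁                          ≡⟨ sym (⊕-⊖-cancel j₁ (s i₁ i₂)) ⟩
        j₁ ⊕ s i₁ i₂ ⊕ ⊖ s i₁ i₂    ≡⟨ cong₂ _⊕_ (across⇒ i₁≢i₂ a₁₂) (sym (antisym i₁≢i₂)) ⟩
        j₂ ⊕ s i₂ i₁                ≡⟨ across⇒ i₂≢i₃ a₂₃ ⟩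
        j₃                          ∎
        where open ≡-Reasoning
    ... | no i₁≢i₂ | no i₂≢i₃ | no i₁≢i₃ =
      contradiction (⊕-cancelˡ j₁ (s i₁ i₂) (s i₂ i₃) (s i₁ i₃) path) (acyclic i₁≢i₂ i₂≢i₃ i₁≢i₃)
      where
      path : j₁ ⊕ s i₁ i₂ ⊕ s i₂ i₃ ≡ j₁ ⊕ s i₁ i₃
      path = trans (cong (_⊕ s i₂ i₃) (across⇒ i₁≢i₂ a₁₂)) (trans (across⇒ i₂≢i₃ a₂₃) (sym (across⇒ i₁≢i₃ a₁₃)))

edgeBound-3-half : ∀ n E → E + E ≡ n * 3 * suc n → E ≡ edgeBound n 3
edgeBound-3-half n E E+E≡ = begin
  E                ≡⟨ sym (m*n/n≡m E 2) ⟩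
  E * 2 / 2        ≡⟨ cong (_/ 2) (trans (ℕ.*-comm E 2) (cong (E +_) (ℕ.+-identityʳ E))) ⟩
  (E + E) / 2      ≡⟨ cong (_/ 2) (trans E+E≡ (sym (numerator n))) ⟩
  edgeBound n 3    ∎
  where
  open ≡-Reasoning
  expand : ∀ m → suc m * (3 * 2) + suc m * 3 * m * 1 ≡ suc m * 3 * suc (suc m)
  expand = solve-∀
  numerator : ∀ n → n * (3 * 2) + n * 3 * (n ∸ 1) * 1 ≡ n * 3 * suc n
  numerator zero    = refl
  numerator (suc m) = expand m

module ShiftGraph {n} {s : Fin n → Fin n → Fin 3} (tournament : IsTransitiveTournament s)
  (G : Graph (n * 3)) (shape : ∀ x y → G x y ≡ ShiftAdj s (remQuot 3 x) (remQuot 3 y)) where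

  layer : Fin (n * 3) → Fin n
  layer x = proj₁ (remQuot {n} 3 x)

  simple : IsSimpleGraph G
  simple = (λ x y → trans (shape x y) (trans (ShiftAdj-symmetric tournament _ _) (sym (shape y x))))
         , (λ x → trans (shape x x) (ShiftAdj-irreflexive _))

  row-degree : ∀ i j k → ∑[ l < 3 ] bit (ShiftAdj s (i , j) (k , l)) ≡ suc (bit (does (i ≟ k)))
  row-degree i j k with i ≟ k
  ... | yes refl = trans (sum-cong-≗ (λ l → cong bit (ShiftAdj-within {s = s} {i} j l refl))) (count-≢ j)
  ... | no  i≢k  = trans (sum-cong-≗ (λ l → cong bit (ShiftAdj-across {s = s} j l i≢k))) (count-≟ (j ⊕ s i k))

  regular : ∀ x → degree G x ≡ suc n
  regular x = begin
    degree G x                                                  ≡⟨ ∑-combine n 3 (λ y → bit (G x y)) ⟩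
    ∑[ k < n ] ∑[ l < 3 ] bit (G x (combine k l))                ≡⟨ sum-cong-≗ (λ k → sum-cong-≗ (λ l → cong bit (G-x k l))) ⟩
    ∑[ k < n ] ∑[ l < 3 ] bit (ShiftAdj s (remQuot 3 x) (k , l))  ≡⟨ sum-cong-≗ (row-degree (layer x) _) ⟩
    ∑[ k < n ] suc (bit (does (layer x ≟ k)))                    ≡⟨ ∑-suc-≟ (layer x) ⟩
    suc n                                                       ∎
    where
    open ≡-Reasoning
    G-x : ∀ k l → G x (combine k l) ≡ ShiftAdj s (remQuot 3 x) (k , l)
    G-x k l = trans (shape x (combine k l)) (cong (ShiftAdj s (remQuot 3 x)) (remQuot-combine k l))

  edgeCount-double : edgeCount G + edgeCount G ≡ n * 3 * suc n
  edgeCount-double = trans (sym (handshake G simple)) (trans (sum-cong-≗ regular) (∑-const (n * 3) (suc n)))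

  Layer : Fin n → Subset (n * 3)
  Layer i = image (combine {n} {3} i)

  ∈Layer⇒ : ∀ {i x} → x ∈ Layer i → layer x ≡ i
  ∈Layer⇒ {i} x∈ with ∈-image (combine i) x∈
  ... | j , refl = cong proj₁ (remQuot-combine i j)

  ∈Layer : ∀ {i} x → layer x ≡ i → x ∈ Layer i
  ∈Layer x refl = subst (_∈ Layer (layer x)) (combine-remQuot {n} 3 x) (image-∋ (combine (layer x)) _)

  ∣Layer∣ : ∀ i → ∣ Layer i ∣ ≡ 3
  ∣Layer∣ i = ∣image∣ (combine i) (combine-injectiveʳ i _ i _)

  decomposition : IsCliqueDecomp G n 3 Layer
  decomposition = (λ i → ∣Layer∣ i , clique i)
                , (λ i k x x∈ᵢ x∈ₖ → trans (sym (∈Layer⇒ x∈ᵢ)) (∈Layer⇒ x∈ₖ))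
                , (λ x → layer x , ∈Layer x refl)
    where
    clique : ∀ i x y → x ∈ Layer i → y ∈ Layer i → x ≢ y → G x y ≡ true
    clique i x y x∈ y∈ x≢y with ∈-image (combine i) x∈ | ∈-image (combine i) y∈
    ... | j , refl | l , refl = begin
      G (combine i j) (combine i l)                                    ≡⟨ shape _ _ ⟩
      ShiftAdj s (remQuot 3 (combine i j)) (remQuot 3 (combine i l))   ≡⟨ cong₂ (ShiftAdj s) (remQuot-combine i j) (remQuot-combine i l) ⟩
      ShiftAdj s (i , j) (i , l)                                       ≡⟨ ShiftAdj-within j l refl ⟩
      not (does (j ≟ l))                                               ≡⟨ cong not (dec-false (j ≟ l) (λ j≡l → x≢y (cong (combine i) j≡l))) ⟩
      true                                                             ∎
      where open ≡-Reasoning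

  triangle-in-layer : ∀ {x y z} → G x y ≡ true → G y z ≡ true → G x z ≡ true → layer x ≡ layer y
  triangle-in-layer {x} {y} {z} xy yz xz =
    ShiftAdj-triangle tournament (trans (sym (shape x y)) xy) (trans (sym (shape y z)) yz) (trans (sym (shape x z)) xz)

  cliques-are-layers : ∀ S → IsClique G 3 S → ∃ λ i → S ≡ Layer i
  cliques-are-layers S (size , clique) with enumerate S size
  ... | e , e-injective , S≡ = i , ⊆∧∣∣≡⇒≡ S⊆Layer (trans size (sym (∣Layer∣ i)))
    where
    adjacent : ∀ a b → a ≢ b → G (e a) (e b) ≡ true
    adjacent a b a≢b = clique (e a) (e b) (subst (e a ∈_) (sym S≡) (image-∋ e a)) (subst (e b ∈_) (sym S≡) (image-∋ e b))
                              (λ eq → a≢b (e-injective eq))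
    i : Fin n
    i = layer (e 0F)
    e-layer : ∀ j → layer (e j) ≡ i
    e-layer 0F = refl
    e-layer 1F = sym (triangle-in-layer (adjacent 0F 1F λ ()) (adjacent 1F 2F λ ()) (adjacent 0F 2F λ ()))
    e-layer 2F = sym (triangle-in-layer (adjacent 0F 2F λ ()) (adjacent 2F 1F λ ()) (adjacent 0F 1F λ ()))
    S⊆Layer : S ⊆ Layer i
    S⊆Layer {x} x∈S with ∈-image e (subst (x ∈_) S≡ x∈S)
    ... | j , refl = ∈Layer (e j) (e-layer j)

  maximal : MaximalStronglyCP n 3 G
  maximal = (simple , Layer , decomposition , cliques-are-blocks⇒unique cliques-are-layers , cliques-are-layers)
          , edgeBound-3-half n (edgeCount G) edgeCount-double

-- Γ(n,3) as a shift graph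

slope : ∀ {n} → Fin n → Fin n → Fin 3
slope i k = if toℕ i <ᵇ toℕ k then 2F else 1F

slope-< : ∀ {n} {i k : Fin n} → toℕ i < toℕ k → slope i k ≡ 2F
slope-< {i = i} {k} i<k = cong (if_then 2F else 1F) (dec-true (i <? k) i<k)

slope-≮ : ∀ {n} {i k : Fin n} → ¬ toℕ i < toℕ k → slope i k ≡ 1F
slope-≮ {i = i} {k} i≮k = cong (if_then 2F else 1F) (dec-false (i <? k) i≮k)

slope-tournament : ∀ {n} → IsTransitiveTournament (slope {n})
slope-tournament = record { nonzero = nonzero ; antisym = antisym ; acyclic = acyclic }
  where
  nonzero : ∀ {b c} → b ≢ c → slope b c ≢ 0F
  nonzero {b} {c} _ with b <? c
  ... | yes b<c rewrite slope-< b<c = λ ()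
  ... | no  b≮c rewrite slope-≮ b≮c = λ ()
  antisym : ∀ {b c} → b ≢ c → slope c b ≡ ⊖ slope b c
  antisym {b} {c} b≢c with Finₚ.<-cmp b c
  ... | tri< b<c _ c≮b rewrite slope-< b<c | slope-≮ c≮b = refl
  ... | tri≈ _ b≡c _   = contradiction b≡c b≢c
  ... | tri> b≮c _ c<b rewrite slope-≮ b≮c | slope-< c<b = refl
  acyclic : ∀ {b c d} → b ≢ c → c ≢ d → b ≢ d → slope b c ⊕ slope c d ≢ slope b d
  acyclic {b} {c} {d} b≢c c≢d b≢d with Finₚ.<-cmp b c | Finₚ.<-cmp c d
  ... | tri≈ _ b≡c _ | _ = contradiction b≡c b≢c
  ... | _ | tri≈ _ c≡d _ = contradiction c≡d c≢d
  ... | tri< b<c _ _ | tri< c<d _ _ rewrite slope-< b<c | slope-< c<d | slope-< (Finₚ.<-trans b<c c<d) = λ ()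
  ... | tri< b<c _ _ | tri> c≮d _ _ rewrite slope-< b<c | slope-≮ c≮d = λ eq → nonzero b≢d (sym eq)
  ... | tri> b≮c _ _ | tri< c<d _ _ rewrite slope-≮ b≮c | slope-< c<d = λ eq → nonzero b≢d (sym eq)
  ... | tri> b≮c _ c<b | tri> c≮d _ d<c
    rewrite slope-≮ b≮c | slope-≮ c≮d | slope-≮ (Finₚ.<-asym (Finₚ.<-trans d<c c<b)) = λ ()

Γ-across : ∀ b (j l : Fin 3) →
  (if b then 2 ≤ᵇ diffMod 3 j l else 2 ≤ᵇ diffMod 3 l j) ≡ does (j ⊕ (if b then 2F else 1F) ≟ l)
Γ-across true  = from-yes (all? λ j → all? λ l → (2 ≤ᵇ diffMod 3 j l) ≟ᵇ does (j ⊕ 2F ≟ l))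
Γ-across false = from-yes (all? λ j → all? λ l → (2 ≤ᵇ diffMod 3 l j) ≟ᵇ does (j ⊕ 1F ≟ l))

Γ-shape : ∀ {n} x y → Γ n 3 x y ≡ ShiftAdj slope (remQuot 3 x) (remQuot 3 y)
Γ-shape {n} x y = ΓAdj-shape (remQuot 3 x) (remQuot 3 y)
  where
  ΓAdj-shape : ∀ p q → ΓAdj n 3 p q ≡ ShiftAdj slope p q
  ΓAdj-shape (i , j) (k , l) with i ≟ k
  ... | yes refl = trans (cong not (isYes≗does (j ≟ l))) (sym (ShiftAdj-within j l refl))
  ... | no  i≢k  = trans (Γ-across (toℕ i <ᵇ toℕ k) j l) (sym (ShiftAdj-across j l i≢k))

Γ-maximal : ∀ n → MaximalStronglyCP n 3 (Γ n 3)
Γ-maximal n = ShiftGraph.maximal (slope-tournament {n}) (Γ n 3) Γ-shape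

-- Read off Γ(n,3), which attains the bound; this avoids a parity argument.
edgeBound-double : ∀ n → edgeBound n 3 + edgeBound n 3 ≡ n * 3 * suc n
edgeBound-double n = subst (λ E → E + E ≡ n * 3 * suc n) (proj₂ (Γ-maximal n))
  (ShiftGraph.edgeCount-double (slope-tournament {n}) (Γ n 3) Γ-shape)

module Ranking {n} {_≺_ : Fin n → Fin n → Set} (compare : Trichotomous _≡_ _≺_) (≺-trans : Transitive _≺_) where

  _≺?_ : ∀ b c → Dec (b ≺ c)
  _≺?_ = tri⇒dec< compare

  ≺-irrefl : ∀ {b} → ¬ b ≺ b
  ≺-irrefl {b} with compare b b
  ... | tri< _ b≢b _ = contradiction refl b≢b
  ... | tri≈ b⊀b _ _ = b⊀b
  ... | tri> _ b≢b _ = contradiction refl b≢b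

  rank : Fin n → ℕ
  rank b = count (λ c → does (c ≺? b))

  rank-< : ∀ b → rank b < n
  rank-< b = begin-strict
    rank b                          ≤⟨ count-mono (λ c → does (c ≺? b)) ((λ _ → true) ∖ b) below ⟩
    count ((λ _ → true) ∖ b)        <⟨ s≤s ℕ.≤-refl ⟩
    suc (count ((λ _ → true) ∖ b))  ≡⟨ sym (count-remove (λ _ → true) {b} refl) ⟩
    count (λ (_ : Fin n) → true)    ≡⟨ trans (∑-const n 1) (ℕ.*-identityʳ n) ⟩
    n                               ∎
    where
    open ℕ.≤-Reasoning
    below : ∀ c → does (c ≺? b) ≡ true → ((λ _ → true) ∖ b) c ≡ true
    below c c≺b = ∖-intro (λ _ → true) {b} refl (λ b≡c → ≺-irrefl (subst (_≺ b) (sym b≡c) (does⇒ (c ≺? b) c≺b)))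

  rank-mono : ∀ {b c} → b ≺ c → rank b < rank c
  rank-mono {b} {c} b≺c = begin-strict
    rank b                                    ≤⟨ count-mono (λ d → does (d ≺? b)) ((λ d → does (d ≺? c)) ∖ b) below ⟩
    count ((λ d → does (d ≺? c)) ∖ b)         <⟨ s≤s ℕ.≤-refl ⟩
    suc (count ((λ d → does (d ≺? c)) ∖ b))   ≡⟨ sym (count-remove (λ d → does (d ≺? c)) (dec-true (b ≺? c) b≺c)) ⟩
    rank c                                    ∎
    where
    open ℕ.≤-Reasoning
    below : ∀ d → does (d ≺? b) ≡ true → ((λ d → does (d ≺? c)) ∖ b) d ≡ true
    below d d≺b = ∖-intro (λ d → does (d ≺? c)) (dec-true (d ≺? c) (≺-trans (does⇒ (d ≺? b) d≺b) b≺c))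
                          (λ b≡d → ≺-irrefl (subst (_≺ b) (sym b≡d) (does⇒ (d ≺? b) d≺b)))

  rankFin : Fin n → Fin n
  rankFin b = fromℕ< (rank-< b)

  rankFin-mono : ∀ {b c} → b ≺ c → toℕ (rankFin b) < toℕ (rankFin c)
  rankFin-mono {b} {c} b≺c = subst₂ _<_ (sym (toℕ-fromℕ< (rank-< b))) (sym (toℕ-fromℕ< (rank-< c))) (rank-mono b≺c)

  rankFin-injective : Injective _≡_ _≡_ rankFin
  rankFin-injective {b} {c} eq with compare b c
  ... | tri< b≺c _ _ = contradiction (cong toℕ eq) (ℕ.<⇒≢ (rankFin-mono b≺c))
  ... | tri≈ _ b≡c _ = b≡c
  ... | tri> _ _ c≺b = contradiction (cong toℕ (sym eq)) (ℕ.<⇒≢ (rankFin-mono c≺b))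

module TournamentOrder {n} {s : Fin n → Fin n → Fin 3} (tournament : IsTransitiveTournament s) where
  open IsTransitiveTournament tournament

  _≺_ : Fin n → Fin n → Set
  b ≺ c = b ≢ c × s b c ≡ 2F

  compare : Trichotomous _≡_ _≺_
  compare b c with b ≟ c
  ... | yes b≡c = tri≈ (λ b≺b → proj₁ b≺b b≡c) b≡c (λ c≺b → proj₁ c≺b (sym b≡c))
  ... | no  b≢c with s b c ≟ 2F
  ...   | yes bc≡2 = tri< (b≢c , bc≡2) b≢c
                          (λ c≺b → contradiction (trans (sym (trans (antisym b≢c) (cong ⊖_ bc≡2))) (proj₂ c≺b)) λ ())
  ...   | no  bc≢2 = tri> (λ b≺c → bc≢2 (proj₂ b≺c)) b≢c
                          ((λ c≡b → b≢c (sym c≡b)) , trans (antisym b≢c) (≢0∧≢2⇒⊖≡2 (s b c) (nonzero b≢c) bc≢2))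

  ≺-trans : Transitive _≺_
  ≺-trans {b} {c} {d} (b≢c , bc≡2) (c≢d , cd≡2) =
    b≢d , ≢0∧≢1⇒≡2 (s b d) (nonzero b≢d) (λ bd≡1 → acyclic b≢c c≢d b≢d (trans (cong₂ _⊕_ bc≡2 cd≡2) (sym bd≡1)))
    where
    b≢d : b ≢ d
    b≢d refl = contradiction (trans (sym (trans (antisym b≢c) (cong ⊖_ bc≡2))) cd≡2) λ ()

  open Ranking compare ≺-trans public using (rankFin; rankFin-mono; rankFin-injective)

  slope-rankFin : ∀ {b c} → b ≢ c → slope (rankFin b) (rankFin c) ≡ s b c
  slope-rankFin {b} {c} b≢c with compare b c
  ... | tri< b≺c _ _ = trans (slope-< (rankFin-mono b≺c)) (sym (proj₂ b≺c))
  ... | tri≈ _ b≡c _ = contradiction b≡c b≢c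
  ... | tri> _ _ c≺b = trans (slope-≮ (ℕ.<⇒≯ (rankFin-mono c≺b))) (sym (trans (antisym (proj₁ c≺b)) (cong ⊖_ (proj₂ c≺b))))

  ShiftAdj-rankFin : ∀ b j c l → ShiftAdj s (b , j) (c , l) ≡ ShiftAdj slope (rankFin b , j) (rankFin c , l)
  ShiftAdj-rankFin b j c l with b ≟ c
  ... | yes b≡c = trans (ShiftAdj-within j l b≡c) (sym (ShiftAdj-within j l (cong rankFin b≡c)))
  ... | no  b≢c = begin
    ShiftAdj s (b , j) (c , l)                      ≡⟨ ShiftAdj-across j l b≢c ⟩
    does (j ⊕ s b c ≟ l)                            ≡⟨ cong (λ t → does (j ⊕ t ≟ l)) (sym (slope-rankFin b≢c)) ⟩
    does (j ⊕ slope (rankFin b) (rankFin c) ≟ l)    ≡⟨ sym (ShiftAdj-across j l (λ eq → b≢c (rankFin-injective eq))) ⟩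
    ShiftAdj slope (rankFin b , j) (rankFin c , l)  ∎
    where open ≡-Reasoning

-- Maximal strongly (n,3)-clique-partitioned graphs

module MaximalGraph {n} (G : Graph (n * 3)) (simple : IsSimpleGraph G) (P : Fin n → Subset (n * 3))
  (decomposition : IsCliqueDecomp G n 3 P) (cliques-are-blocks : ∀ S → IsClique G 3 S → ∃ λ i → S ≡ P i)
  (edges : edgeCount G ≡ edgeBound n 3) where

  block : Fin (n * 3) → Fin n
  block x = proj₁ (proj₂ (proj₂ decomposition) x)

  ∈-block : ∀ x → x ∈ P (block x)
  ∈-block x = proj₂ (proj₂ (proj₂ decomposition) x)

  ∈⇒block : ∀ {b x} → x ∈ P b → block x ≡ b
  ∈⇒block {b} {x} x∈ = proj₁ (proj₂ decomposition) (block x) b x (∈-block x) x∈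

  lookup-P : ∀ b x → lookup (P b) x ≡ does (block x ≟ b)
  lookup-P b x with block x ≟ b
  ... | yes refl = ∈⇒lookup (∈-block x)
  ... | no  bx≢b = ¬-not (λ x∈ → bx≢b (∈⇒block (lookup⇒∈ x∈)))

  same-block⇒adjacent : ∀ {x y} → block x ≡ block y → x ≢ y → G x y ≡ true
  same-block⇒adjacent {x} {y} eq x≢y =
    proj₂ (proj₁ decomposition (block x)) x y (∈-block x) (subst (λ b → y ∈ P b) (sym eq) (∈-block y)) x≢y

  triangle⇒same-block : ∀ {x y z} → G x y ≡ true → G y z ≡ true → G x z ≡ true → block x ≡ block y
  triangle⇒same-block {x} {y} {z} xy yz xz with cliques-are-blocks _ (triangle-clique simple xy yz xz)
  ... | b , S≡P = trans (∈⇒block (member 0F)) (sym (∈⇒block (member 1F)))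
    where
    member : ∀ j → lookup (x ∷ y ∷ z ∷ []) j ∈ P b
    member j = subst (_ ∈_) S≡P (image-∋ (lookup (x ∷ y ∷ z ∷ [])) j)

  neighbours : Fin n → Fin (n * 3) → Fin (n * 3) → Bool
  neighbours b x y = lookup (P b) y ∧ G x y

  neighbour⇒block : ∀ {b x y} → neighbours b x y ≡ true → block y ≡ b
  neighbour⇒block {b} {x} {y} h = ∈⇒block (lookup⇒∈ (proj₁ ∧-conical (lookup (P b) y) (G x y) h))

  neighbour⇒adjacent : ∀ {b x y} → neighbours b x y ≡ true → G x y ≡ true
  neighbour⇒adjacent {b} {x} {y} h = proj₂ ∧-conical (lookup (P b) y) (G x y) h

  adjacent⇒neighbour : ∀ {b x y} → block y ≡ b → G x y ≡ true → neighbours b x y ≡ true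
  adjacent⇒neighbour {b} {x} {y} by≡b xy rewrite lookup-P b y | dec-true (block y ≟ b) by≡b | xy = refl

  degree-by-blocks : ∀ x → degree G x ≡ ∑[ b < n ] count (neighbours b x)
  degree-by-blocks x = trans (sum-cong-≗ split) (∑-comm (λ y b → bit (neighbours b x y)))
    where
    split : ∀ y → bit (G x y) ≡ ∑[ b < n ] bit (neighbours b x y)
    split y with G x y
    ... | true  = sym (trans (sum-cong-≗ (λ b → cong bit (trans (∧-identityʳ (lookup (P b) y)) (lookup-P b y))))
                             (count-≟ (block y)))
    ... | false = sym (trans (sum-cong-≗ (λ b → cong bit (∧-zeroʳ (lookup (P b) y)))) (sum-replicate-zero n))

  capacity : Fin n → Fin (n * 3) → ℕ
  capacity b x = suc (bit (does (block x ≟ b)))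

  neighbours≤capacity : ∀ b x → count (neighbours b x) ≤ capacity b x
  neighbours≤capacity b x with block x ≟ b
  ... | yes refl = begin
    count (neighbours (block x) x)    ≤⟨ count-mono (neighbours (block x) x) (lookup (P (block x)) ∖ x) others ⟩
    count (lookup (P (block x)) ∖ x)  ≡⟨ ℕ.suc-injective (trans (sym (count-remove (lookup (P (block x))) (∈⇒lookup (∈-block x)))) size) ⟩
    2                                 ∎
    where
    open ℕ.≤-Reasoning
    others : ∀ y → neighbours (block x) x y ≡ true → (lookup (P (block x)) ∖ x) y ≡ true
    others y h = ∖-intro (lookup (P (block x))) (proj₁ ∧-conical _ _ h) (adjacent⇒≢ simple (neighbour⇒adjacent h))
    size : count (lookup (P (block x))) ≡ 3
    size = trans (sym (∣∣≡count (P (block x)))) (proj₁ (proj₁ decomposition (block x)))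
  ... | no bx≢b = count≤1 (neighbours b x) at-most-one
    where
    at-most-one : ∀ y y′ → neighbours b x y ≡ true → neighbours b x y′ ≡ true → y ≡ y′
    at-most-one y y′ h h′ with y ≟ y′
    ... | yes y≡y′ = y≡y′
    ... | no  y≢y′ = contradiction (trans (triangle⇒same-block (neighbour⇒adjacent h) y~y′ (neighbour⇒adjacent h′))
                                          (neighbour⇒block h)) bx≢b
      where
      y~y′ : G y y′ ≡ true
      y~y′ = same-block⇒adjacent (trans (neighbour⇒block h) (sym (neighbour⇒block h′))) y≢y′

  degree≤ : ∀ x → degree G x ≤ suc n
  degree≤ x = begin
    degree G x                         ≡⟨ degree-by-blocks x ⟩
    ∑[ b < n ] count (neighbours b x)  ≤⟨ ∑-mono-≤ (λ b → neighbours≤capacity b x) ⟩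
    ∑[ b < n ] capacity b x            ≡⟨ ∑-suc-≟ (block x) ⟩
    suc n                              ∎
    where open ℕ.≤-Reasoning

  regular : ∀ x → degree G x ≡ suc n
  regular = ∑-≤-≡⇒≗ degree≤ (begin
    ∑[ x < n * 3 ] degree G x      ≡⟨ handshake G simple ⟩
    edgeCount G + edgeCount G      ≡⟨ cong₂ _+_ edges edges ⟩
    edgeBound n 3 + edgeBound n 3  ≡⟨ edgeBound-double n ⟩
    n * 3 * suc n                  ≡⟨ sym (∑-const (n * 3) (suc n)) ⟩
    ∑[ x < n * 3 ] suc n           ∎)
    where open ≡-Reasoning

  neighbours≡capacity : ∀ b x → count (neighbours b x) ≡ capacity b x
  neighbours≡capacity b x = ∑-≤-≡⇒≗ (λ c → neighbours≤capacity c x)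
    (trans (sym (degree-by-blocks x)) (trans (regular x) (sym (∑-suc-≟ (block x))))) b

  opaque
    partner : Fin (n * 3) → Fin n → Fin (n * 3)
    partner x b = proj₁ (count-pos⇒∃ (neighbours b x) (subst (0 <_) (sym (neighbours≡capacity b x)) (s≤s z≤n)))

    partner-neighbour : ∀ x b → neighbours b x (partner x b) ≡ true
    partner-neighbour x b = proj₂ (count-pos⇒∃ (neighbours b x) (subst (0 <_) (sym (neighbours≡capacity b x)) (s≤s z≤n)))

  block-partner : ∀ x b → block (partner x b) ≡ b
  block-partner x b = neighbour⇒block (partner-neighbour x b)

  partner-adjacent : ∀ x b → G x (partner x b) ≡ true
  partner-adjacent x b = neighbour⇒adjacent (partner-neighbour x b)

  partner-unique : ∀ {x b y} → block x ≢ b → block y ≡ b → G x y ≡ true → y ≡ partner x b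
  partner-unique {x} {b} {y} bx≢b by≡b xy = count≡1⇒unique (neighbours b x)
    (trans (neighbours≡capacity b x) (cong (suc ∘ bit) (dec-false (block x ≟ b) bx≢b)))
    (adjacent⇒neighbour by≡b xy) (partner-neighbour x b)

  partner-back : ∀ {x b c} → block x ≡ b → b ≢ c → partner (partner x c) b ≡ x
  partner-back {x} {b} {c} bx≡b b≢c = sym (partner-unique (λ eq → b≢c (trans (sym eq) (block-partner x c))) bx≡b
                                                          (trans (proj₁ simple (partner x c) x) (partner-adjacent x c)))

  module Coordinates (r : Fin n) where

    private
      reference : Σ (Fin 3 → Fin (n * 3)) λ e → Injective _≡_ _≡_ e × P r ≡ image e
      reference = enumerate (P r) (proj₁ (proj₁ decomposition r))

    e : Fin 3 → Fin (n * 3)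
    e = proj₁ reference

    e-injective : Injective _≡_ _≡_ e
    e-injective = proj₁ (proj₂ reference)

    block-e : ∀ j → block (e j) ≡ r
    block-e j = ∈⇒block (subst (e j ∈_) (sym (proj₂ (proj₂ reference))) (image-∋ e j))

    block≡r⇒e : ∀ {y} → block y ≡ r → ∃ λ j → e j ≡ y
    block≡r⇒e {y} refl = ∈-image e (subst (y ∈_) (proj₂ (proj₂ reference)) (∈-block y))

    -- The offset on the reference block makes every inter-block shift nonzero.
    opaque
      vertex : Fin n → Fin 3 → Fin (n * 3)
      vertex b j with b ≟ r
      ... | yes _ = e j
      ... | no  _ = partner (e (j ⊕ 1F)) b

      vertex-r : ∀ j → vertex r j ≡ e j
      vertex-r j with r ≟ r
      ... | yes _   = refl
      ... | no  r≢r = contradiction refl r≢r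

      vertex-≢r : ∀ {b} j → b ≢ r → vertex b j ≡ partner (e (j ⊕ 1F)) b
      vertex-≢r {b} j b≢r with b ≟ r
      ... | yes b≡r = contradiction b≡r b≢r
      ... | no  _   = refl

    block-vertex : ∀ b j → block (vertex b j) ≡ b
    block-vertex b j with b ≟ r
    ... | yes refl = trans (cong block (vertex-r j)) (block-e j)
    ... | no  b≢r  = trans (cong block (vertex-≢r j b≢r)) (block-partner _ b)

    partner-r : ∀ {b} j → b ≢ r → partner (vertex b j) r ≡ e (j ⊕ 1F)
    partner-r j b≢r = trans (cong (λ v → partner v r) (vertex-≢r j b≢r)) (partner-back (block-e (j ⊕ 1F)) (λ r≡b → b≢r (sym r≡b)))

    vertex-injective : ∀ b {j l} → vertex b j ≡ vertex b l → j ≡ l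
    vertex-injective b {j} {l} eq with b ≟ r
    ... | yes refl = e-injective (trans (sym (vertex-r j)) (trans eq (vertex-r l)))
    ... | no  b≢r  = ⊕-injectiveˡ 1F j l
      (e-injective (trans (sym (partner-r j b≢r)) (trans (cong (λ v → partner v r) eq) (partner-r l b≢r))))

    vertex-surjective : ∀ y → ∃ λ j → vertex (block y) j ≡ y
    vertex-surjective y with block y ≟ r
    ... | yes by≡r with block≡r⇒e by≡r
    ...   | j , ej≡y = j , trans (cong (λ b → vertex b j) by≡r) (trans (vertex-r j) ej≡y)
    vertex-surjective y | no by≢r with block≡r⇒e (block-partner y r)
    ...   | j , ej≡py = j ⊕ 2F , (begin
      vertex (block y) (j ⊕ 2F)            ≡⟨ vertex-≢r (j ⊕ 2F) by≢r ⟩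
      partner (e (j ⊕ 2F ⊕ 1F)) (block y)  ≡⟨ cong (λ i → partner (e i) (block y)) (j⊕2⊕1≡j j) ⟩
      partner (e j) (block y)              ≡⟨ cong (λ v → partner v (block y)) ej≡py ⟩
      partner (partner y r) (block y)      ≡⟨ partner-back refl by≢r ⟩
      y                                    ∎)
      where open ≡-Reasoning

    opaque
      label : Fin (n * 3) → Fin 3
      label y = proj₁ (vertex-surjective y)

      vertex-label : ∀ y → vertex (block y) (label y) ≡ y
      vertex-label y = proj₂ (vertex-surjective y)

    label-vertex : ∀ b j → label (vertex b j) ≡ j
    label-vertex b j = vertex-injective b
      (subst (λ c → vertex c (label (vertex b j)) ≡ vertex b j) (block-vertex b j) (vertex-label (vertex b j)))

    label-injective : ∀ {y y′} → block y ≡ block y′ → label y ≡ label y′ → y ≡ y′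
    label-injective {y} {y′} blocks≡ labels≡ =
      trans (sym (vertex-label y)) (trans (cong₂ vertex blocks≡ labels≡) (vertex-label y′))

    transfer : Fin n → Fin n → Fin 3 → Fin 3
    transfer b c j = label (partner (vertex b j) c)

    transfer-injective : ∀ {b c} → b ≢ c → Injective _≡_ _≡_ (transfer b c)
    transfer-injective {b} {c} b≢c {j} {l} eq = vertex-injective b (begin
      vertex b j                          ≡⟨ sym (partner-back (block-vertex b j) b≢c) ⟩
      partner (partner (vertex b j) c) b  ≡⟨ cong (λ v → partner v b) partners≡ ⟩
      partner (partner (vertex b l) c) b  ≡⟨ partner-back (block-vertex b l) b≢c ⟩
      vertex b l                          ∎)
      where
      open ≡-Reasoning
      partners≡ : partner (vertex b j) c ≡ partner (vertex b l) c
      partners≡ = label-injective (trans (block-partner _ c) (sym (block-partner _ c))) eq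

    no-fixed-partner : ∀ {b c} → b ≢ c → ∀ j → partner (vertex b j) c ≢ vertex c j
    no-fixed-partner {b} {c} b≢c j fixed with b ≟ r | c ≟ r
    ... | yes refl | yes refl = b≢c refl
    ... | yes refl | no  c≢r  = j⊕1≢j j (sym (e-injective (begin
      e j                                 ≡⟨ sym (partner-back (block-e j) b≢c) ⟩
      partner (partner (e j) c) b         ≡⟨ cong (λ v → partner (partner v c) b) (sym (vertex-r j)) ⟩
      partner (partner (vertex b j) c) b  ≡⟨ cong (λ v → partner v b) fixed ⟩
      partner (vertex c j) b              ≡⟨ partner-r j c≢r ⟩
      e (j ⊕ 1F)                          ∎)))
      where open ≡-Reasoning
    ... | no  b≢r  | yes refl = j⊕1≢j j (e-injective (begin
      e (j ⊕ 1F)                          ≡⟨ sym (partner-r j b≢r) ⟩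
      partner (vertex b j) c              ≡⟨ fixed ⟩
      vertex c j                          ≡⟨ vertex-r j ⟩
      e j                                 ∎))
      where open ≡-Reasoning
    ... | no  b≢r  | no  c≢r  = b≢r (sym (trans (sym (block-e (j ⊕ 1F))) (trans (triangle⇒same-block x~y y~w x~w) (block-vertex b j))))
      where
      x : Fin (n * 3)
      x = e (j ⊕ 1F)
      x~y : G x (vertex b j) ≡ true
      x~y = subst (λ v → G x v ≡ true) (sym (vertex-≢r j b≢r)) (partner-adjacent x b)
      y~w : G (vertex b j) (vertex c j) ≡ true
      y~w = subst (λ v → G (vertex b j) v ≡ true) fixed (partner-adjacent (vertex b j) c)
      x~w : G x (vertex c j) ≡ true
      x~w = subst (λ v → G x v ≡ true) (sym (vertex-≢r j c≢r)) (partner-adjacent x c)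

    transfer-fixed-point-free : ∀ {b c} → b ≢ c → ∀ j → transfer b c j ≢ j
    transfer-fixed-point-free {b} {c} b≢c j eq = no-fixed-partner b≢c j
      (label-injective (trans (block-partner _ c) (sym (block-vertex c j))) (trans eq (sym (label-vertex c j))))

    shift : Fin n → Fin n → Fin 3
    shift b c = transfer b c 0F

    label-partner : ∀ {y b c} → block y ≡ b → b ≢ c → label (partner y c) ≡ label y ⊕ shift b c
    label-partner {y} {b} {c} refl b≢c = begin
      label (partner y c)      ≡⟨ cong (λ v → label (partner v c)) (sym (vertex-label y)) ⟩
      transfer b c (label y)   ≡⟨ derangement-is-rotation (transfer b c) (transfer-injective b≢c) (transfer-fixed-point-free b≢c) (label y) ⟩
      label y ⊕ shift b c      ∎
      where open ≡-Reasoning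

    shift-tournament : IsTransitiveTournament shift
    shift-tournament = record { nonzero = nonzero ; antisym = antisym ; acyclic = acyclic }
      where
      nonzero : ∀ {b c} → b ≢ c → shift b c ≢ 0F
      nonzero b≢c = transfer-fixed-point-free b≢c 0F
      antisym : ∀ {b c} → b ≢ c → shift c b ≡ ⊖ shift b c
      antisym {b} {c} b≢c = ⊕-inverse-unique (label y) (shift b c) (shift c b) (begin
        label y ⊕ shift b c ⊕ shift c b  ≡⟨ cong (_⊕ shift c b) (sym (label-partner (block-vertex b 0F) b≢c)) ⟩
        label (partner y c) ⊕ shift c b  ≡⟨ sym (label-partner (block-partner y c) (λ c≡b → b≢c (sym c≡b))) ⟩
        label (partner (partner y c) b)  ≡⟨ cong label (partner-back (block-vertex b 0F) b≢c) ⟩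
        label y                          ∎)
        where
        open ≡-Reasoning
        y : Fin (n * 3)
        y = vertex b 0F
      acyclic : ∀ {b c d} → b ≢ c → c ≢ d → b ≢ d → shift b c ⊕ shift c d ≢ shift b d
      acyclic {b} {c} {d} b≢c c≢d b≢d path =
        b≢c (trans (sym (block-vertex b 0F)) (trans (triangle⇒same-block y~w w~z y~z) (block-partner y c)))
        where
        y w z : Fin (n * 3)
        y = vertex b 0F
        w = partner y c
        z = partner w d
        z≡ : z ≡ partner y d
        z≡ = label-injective (trans (block-partner w d) (sym (block-partner y d))) (begin
          label z                            ≡⟨ label-partner (block-partner y c) c≢d ⟩
          label w ⊕ shift c d                ≡⟨ cong (_⊕ shift c d) (label-partner (block-vertex b 0F) b≢c) ⟩
          label y ⊕ shift b c ⊕ shift c d    ≡⟨ ⊕-assoc (label y) (shift b c) (shift c d) ⟩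
          label y ⊕ (shift b c ⊕ shift c d)  ≡⟨ cong (label y ⊕_) path ⟩
          label y ⊕ shift b d                ≡⟨ sym (label-partner (block-vertex b 0F) b≢d) ⟩
          label (partner y d)                ∎)
          where open ≡-Reasoning
        y~w : G y w ≡ true
        y~w = partner-adjacent y c
        w~z : G w z ≡ true
        w~z = partner-adjacent w d
        y~z : G y z ≡ true
        y~z = subst (λ v → G y v ≡ true) (sym z≡) (partner-adjacent y d)

    G-shape : ∀ y y′ → G y y′ ≡ ShiftAdj shift (block y , label y) (block y′ , label y′)
    G-shape y y′ with block y ≟ block y′
    ... | yes same = trans within (sym (ShiftAdj-within (label y) (label y′) same))
      where
      adjacency : G y y′ ≡ not (does (y ≟ y′))
      adjacency with y ≟ y′
      ... | yes refl = proj₂ simple y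
      ... | no  y≢y′ = same-block⇒adjacent same y≢y′
      within : G y y′ ≡ not (does (label y ≟ label y′))
      within = trans adjacency (cong not (does-⇔ (mk⇔ (cong label) (label-injective same)) (y ≟ y′) (label y ≟ label y′)))
    ... | no  different = trans across (sym (ShiftAdj-across (label y) (label y′) different))
      where
      across : G y y′ ≡ does (label y ⊕ shift (block y) (block y′) ≟ label y′)
      across = bool-does
        (λ y~y′ → trans (sym (label-partner refl different)) (cong label (sym (partner-unique different refl y~y′))))
        (λ labels≡ → subst (λ v → G y v ≡ true)
           (label-injective (block-partner y (block y′)) (trans (label-partner refl different) labels≡))
           (partner-adjacent y (block y′)))
        (label y ⊕ shift (block y) (block y′) ≟ label y′)

    isomorphic : Isomorphic G (Γ n 3)
    isomorphic = π , λ y y′ → begin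
      G y y′                                                    ≡⟨ G-shape y y′ ⟩
      ShiftAdj shift (block y , label y) (block y′ , label y′)  ≡⟨ ShiftAdj-rankFin (block y) (label y) (block y′) (label y′) ⟩
      ShiftAdj slope (rankFin (block y) , label y) (rankFin (block y′) , label y′)
        ≡⟨ sym (cong₂ (ShiftAdj slope) (remQuot-combine (rankFin (block y)) (label y)) (remQuot-combine (rankFin (block y′)) (label y′))) ⟩
      ShiftAdj slope (remQuot 3 (σ y)) (remQuot 3 (σ y′))       ≡⟨ sym (Γ-shape (σ y) (σ y′)) ⟩
      Γ n 3 (σ y) (σ y′)                                       ≡⟨ sym (cong₂ (Γ n 3) (π≗σ y) (π≗σ y′)) ⟩
      Γ n 3 (π ⟨$⟩ʳ y) (π ⟨$⟩ʳ y′)                              ∎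
      where
      open ≡-Reasoning
      open TournamentOrder shift-tournament
      σ : Fin (n * 3) → Fin (n * 3)
      σ y = combine (rankFin (block y)) (label y)
      σ-injective : Injective _≡_ _≡_ σ
      σ-injective {y} {y′} eq with combine-injective (rankFin (block y)) (label y) (rankFin (block y′)) (label y′) eq
      ... | ranks≡ , labels≡ = label-injective (rankFin-injective ranks≡) labels≡
      π : Permutation′ (n * 3)
      π = proj₁ (injective⇒permutation σ σ-injective)
      π≗σ : ∀ y → π ⟨$⟩ʳ y ≡ σ y
      π≗σ = proj₂ (injective⇒permutation σ σ-injective)

theorem2p9 : (n : ℕ) → 2 ≤ n →
    MaximalStronglyCP n 3 (Γ n 3) ×
    (∀ (G : Graph (n * 3)) → MaximalStronglyCP n 3 G → Isomorphic G (Γ n 3))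
theorem2p9 zero    ()
theorem2p9 (suc m) _ = Γ-maximal (suc m) , λ G ((simple , P , decomposition , _ , cliques-are-blocks) , edges) →
  MaximalGraph.Coordinates.isomorphic G simple P decomposition cliques-are-blocks edges zero
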